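{- There is an isomorphism of right $\mathsf{PlanEq}$-modules $\mathsf{Perm}\cong\overline{\mathsf{Ham}}\circ\mathsf{PlanEq}$; that is, $\mathsf{Perm}$ is the free right $\mathsf{PlanEq}$-module generated by $\overline{\mathsf{Ham}}$.
   Context: Graphs are finite, simple, undirected; a tube is a nonempty vertex set inducing a connected subgraph; $\Gamma/G$ contracts the tube $G$ to a vertex $\{G\}$; for a partition $I$ of $V_\Gamma$ into tubes, $\Gamma/I$ has the blocks as vertices, adjacent iff their union is a tube. $\overline{\Gamma}$ is the complement graph. Over a field $\mathsf{k}$, all collections are indexed by nonempty connected graphs and functorial in isomorphisms. For collections $\mathcal{V},\mathcal{P}$: $(\mathcal{V}\circ\mathcal{P})(\Gamma)=\bigoplus_{I}\mathcal{V}(\Gamma/I)\otimes\bigotimes_{G\in I}\mathcal{P}(\Gamma|_G)$; when $\mathcal{P}$ is a contractad this is the free right $\mathcal{P}$-module on $\mathcal{V}$. $\mathsf{Perm}(\Gamma)$ has basis all orderings $(v_1,\dots,v_n)$ of $V_\Gamma$, with contractad structure given by substitution $(u_1,\dots,\{G\},\dots,u_k)\circ^\Gamma_G(w_1,\dots,w_m)=(u_1,\dots,w_1,\dots,w_m,\dots,u_k)$. $\mathsf{PlanEq}(\Gamma)\subseteq\mathsf{Perm}(\Gamma)$ is spanned by the orderings that are left-to-right leaf sequences of $\Gamma$-admissible planar binary trees (planar rooted trees, internal vertices with two children, leaves labelled bijectively by $V_\Gamma$, leaf set below each vertex a tube); it is a subcontractad, and $\mathsf{Perm}$ is a right $\mathsf{PlanEq}$-module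 by restriction. $\overline{\mathsf{Ham}}(\Gamma)$ is the vector space with basis the directed Hamiltonian paths of $\overline{\Gamma}$ (orderings of $V_\Gamma$ in which no two consecutive vertices are adjacent in $\Gamma$). -}

module Defs where

open import Level using (Level; _⊔_; 0ℓ) renaming (suc to lsuc)
open import Function using (_∘_)
open import Data.Bool using (Bool; true; false; _∧_; _∨_; not; if_then_else_; T; T?)
open import Data.Nat using (ℕ; zero; suc)
open import Data.List using (List; []; _∷_; _++_; map; concat; concatMap; length; filter; filterᵇ; foldr)
open import Data.Bool.ListAction using (all; any)
open import Data.List.Membership.Propositional using (_∈_)
open import Data.List.Relation.Unary.Unique.Propositional using (Unique)
import Data.List.Relation.Unary.Unique.Propositional.Properties as UP
open import Data.List.Relation.Unary.All using (All; []; _∷_)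
open import Data.List.Relation.Unary.AllPairs using ([]; _∷_)
import Data.List.Properties as LP
open import Data.Maybe using (Maybe; just; nothing)
import Data.Maybe.Properties as MP
open import Data.Product using (Σ; _×_; _,_)
open import Relation.Binary.PropositionalEquality using (_≡_; _≢_; refl)
open import Relation.Nullary using (¬_; does)
open import Relation.Binary using (DecidableEquality)
open import Algebra.Bundles using (CommutativeRing)

record Field (c ℓ : Level) : Set (lsuc (c ⊔ ℓ)) where
  field
    commutativeRing : CommutativeRing c ℓ
  open CommutativeRing commutativeRing public
  field
    1≉0     : ¬ (1# ≈ 0#)
    inverse : ∀ x → ¬ (x ≈ 0#) → Σ Carrier (λ y → (x * y) ≈ 1#)

record Graph : Set₁ where
  field
    V          : Set
    _≟_        : DecidableEquality V
    vs         : List V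
    vs-unique  : Unique vs
    adj        : V → V → Bool
    adj-sym    : ∀ u v → adj u v ≡ adj v u
    adj-irrefl : ∀ v → adj v v ≡ false

module GraphOps (Γ : Graph) where
  open Graph Γ

  _∈ᵇ_ : V → List V → Bool
  v ∈ᵇ xs = any (λ u → does (u ≟ v)) xs

  _⊆ᵇ_ : List V → List V → Bool
  xs ⊆ᵇ ys = all (_∈ᵇ ys) xs

  uniqueᵇ : List V → Bool
  uniqueᵇ []       = true
  uniqueᵇ (x ∷ xs) = not (x ∈ᵇ xs) ∧ uniqueᵇ xs

  bfsStep : List V → List V → List V
  bfsStep S R = filterᵇ (λ v → (v ∈ᵇ R) ∨ any (λ u → adj u v) R) S

  reach : ℕ → List V → List V → List V
  reach zero    S R = R
  reach (suc n) S R = reach n S (bfsStep S R)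

  isConnectedSet : List V → Bool
  isConnectedSet []      = false
  isConnectedSet (s ∷ S) = (s ∷ S) ⊆ᵇ reach (length (s ∷ S)) (s ∷ S) (s ∷ [])

  isTube : List V → Bool
  isTube S = (S ⊆ᵇ vs) ∧ isConnectedSet S

  isOrderingOf : List V → List V → Bool
  isOrderingOf S w = uniqueᵇ w ∧ (w ⊆ᵇ S) ∧ (S ⊆ᵇ w)

  -- basis of Perm(Γ): orderings of V_Γ
  isOrdering : List V → Bool
  isOrdering = isOrderingOf vs

  splits : List V → List (List V × List V)
  splits []           = []
  splits (x ∷ [])     = []
  splits (x ∷ y ∷ xs) = ((x ∷ []) , (y ∷ xs)) ∷ map (λ p → (x ∷ Data.Product.proj₁ p) , Data.Product.proj₂ p) (splits (y ∷ xs))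

  -- planTree n w: w is the leaf sequence of a planar binary tree in which
  -- the leaf set below every vertex is a tube (n is fuel, n ≥ length w suffices)
  planTree : ℕ → List V → Bool
  planTree _       []       = false
  planTree _       (x ∷ []) = true
  planTree zero    _        = false
  planTree (suc n) w        = any (λ p → isTube (Data.Product.proj₁ p) ∧ isTube (Data.Product.proj₂ p)
                                    ∧ planTree n (Data.Product.proj₁ p) ∧ planTree n (Data.Product.proj₂ p)) (splits w)

  -- w is the leaf sequence of a (Γ restricted to the elements of w)-admissible
  -- planar binary tree (root leaf set = all of w must be a tube as well)
  isPlanEq : List V → Bool
  isPlanEq w = isTube w ∧ planTree (length w) w

  -- Ham-bar of the complement of Γ/I: consecutive blocks are not adjacent
  -- in Γ/I, i.e. their union is not a tube
  consecutiveNonAdj : List (List V) → Bool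
  consecutiveNonAdj []             = true
  consecutiveNonAdj (b ∷ [])       = true
  consecutiveNonAdj (b ∷ b' ∷ bs)  = not (isTube (b ++ b')) ∧ consecutiveNonAdj (b' ∷ bs)

  -- basis of (Ham-bar ∘ PlanEq)(Γ): a list of blocks [B₁,…,Bₖ]; the blocks
  -- form a partition I of V_Γ into tubes, their order is a directed
  -- Hamiltonian path of the complement of Γ/I, and each block, read as an
  -- ordering of its vertices, is a basis element of PlanEq(Γ|_{Bᵢ}).
  isHamPlan : List (List V) → Bool
  isHamPlan c = isOrdering (concat c) ∧ all isTube c ∧ all isPlanEq c ∧ consecutiveNonAdj c

  isConnected : Bool
  isConnected = isConnectedSet vs

-- Contraction Γ/G : the vertex 'nothing' is {G}, 'just v' is v ∉ G.

private
  nothing∉ : {A : Set} (xs : List A) → All (λ y → nothing ≢ y) (map just xs)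
  nothing∉ []       = []
  nothing∉ (x ∷ xs) = (λ ()) ∷ nothing∉ xs

  just-inj : {A : Set} {x y : A} → just x ≡ just y → x ≡ y
  just-inj refl = refl

contract : (Γ : Graph) → List (Graph.V Γ) → Graph
contract Γ G = record
  { V          = Maybe V
  ; _≟_        = MP.≡-dec _≟_
  ; vs         = nothing ∷ map just rest
  ; vs-unique  = nothing∉ rest ∷ UP.map⁺ just-inj (UP.filter⁺ (T? ∘ λ v → not (v ∈ᵇ G)) vs-unique)
  ; adj        = adj'
  ; adj-sym    = sym'
  ; adj-irrefl = irr'
  }
  where
  open Graph Γ
  open GraphOps Γ
  rest : List V
  rest = filterᵇ (λ v → not (v ∈ᵇ G)) vs
  adj' : Maybe V → Maybe V → Bool
  adj' nothing  nothing  = false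
  adj' nothing  (just v) = any (adj v) G
  adj' (just u) nothing  = any (adj u) G
  adj' (just u) (just v) = adj u v
  sym' : ∀ u v → adj' u v ≡ adj' v u
  sym' nothing  nothing  = refl
  sym' nothing  (just v) = refl
  sym' (just u) nothing  = refl
  sym' (just u) (just v) = adj-sym u v
  irr' : ∀ v → adj' v v ≡ false
  irr' nothing  = refl
  irr' (just v) = adj-irrefl v

substVertex : {A : Set} → List A → Maybe A → List A
substVertex q nothing  = q
substVertex q (just v) = v ∷ []

substOrd : {A : Set} → List A → List (Maybe A) → List A
substOrd q u = concatMap (substVertex q) u

insertions : {A : Set} → A → List A → List (List A)
insertions x []       = (x ∷ []) ∷ []
insertions x (y ∷ ys) = (x ∷ y ∷ ys) ∷ map (y ∷_) (insertions x ys)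

perms : {A : Set} → List A → List (List A)
perms []       = [] ∷ []
perms (x ∷ xs) = concatMap (insertions x) (perms xs)

-- A basis is given as the elements of a raw type A satisfying a Boolean
-- predicate 'valid'; a vector is a function A → F, and two vectors are
-- equal when they agree on all valid basis elements (so the space is F^{valid}).

module LinearAlgebra {c ℓ : Level} (F : Field c ℓ) where
  open Field F

  EqOn : {A : Set} → (A → Bool) → (A → Carrier) → (A → Carrier) → Set ℓ
  EqOn valid x y = ∀ a → T (valid a) → x a ≈ y a

  record LinMap {A B : Set} (vA : A → Bool) (vB : B → Bool) : Set (c ⊔ ℓ) where
    field
      app      : (A → Carrier) → (B → Carrier)
      resp     : ∀ x y → EqOn vA x y → EqOn vB (app x) (app y)
      additive : ∀ x y → EqOn vB (app (λ a → x a + y a)) (λ b → app x b + app y b)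
      homog    : ∀ s x → EqOn vB (app (λ a → s * x a)) (λ b → s * app x b)
  open LinMap public

  δ : {A : Set} → DecidableEquality A → A → (A → Carrier)
  δ _≟_ a a' = if does (a ≟ a') then 1# else 0#

  sumF : List Carrier → Carrier
  sumF = foldr _+_ 0#

record GraphIso (Γ Δ : Graph) : Set where
  private
    module Γ = Graph Γ
    module Δ = Graph Δ
  field
    to       : Γ.V → Δ.V
    from     : Δ.V → Γ.V
    to∈      : ∀ v → v ∈ Γ.vs → to v ∈ Δ.vs
    from∈    : ∀ w → w ∈ Δ.vs → from w ∈ Γ.vs
    from-to  : ∀ v → v ∈ Γ.vs → from (to v) ≡ v
    to-from  : ∀ w → w ∈ Δ.vs → to (from w) ≡ w
    adj-pres : ∀ u v → u ∈ Γ.vs → v ∈ Γ.vs → Δ.adj (to u) (to v) ≡ Γ.adj u v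

-- The statement: an isomorphism of right PlanEq-modules
--   ψ : Ham-bar ∘ PlanEq  ≅  Perm
-- given componentwise on nonempty connected graphs, natural in graph
-- isomorphisms, linear, invertible, and compatible with the right
-- PlanEq-actions (checked on basis elements; both actions are bilinear).

module _ {c ℓ : Level} (F : Field c ℓ) where
  open Field F
  open LinearAlgebra F

  HPBasis : (Γ : Graph) → List (List (Graph.V Γ)) → Bool
  HPBasis Γ = GraphOps.isHamPlan Γ

  PermBasis : (Γ : Graph) → List (Graph.V Γ) → Bool
  PermBasis Γ = GraphOps.isOrdering Γ

  Connected : Graph → Set
  Connected Γ = T (GraphOps.isConnected Γ)

  decOrd : (Γ : Graph) → DecidableEquality (List (Graph.V Γ))
  decOrd Γ = LP.≡-dec (Graph._≟_ Γ)

  decHP : (Γ : Graph) → DecidableEquality (List (List (Graph.V Γ)))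
  decHP Γ = LP.≡-dec (decOrd Γ)

  -- right action of q ∈ PlanEq(Γ|G) on Perm, extended linearly:
  -- (y ∘_G q)(w) = Σ_{u ordering of Γ/G, u ∘_G q = w} y(u)
  permAct : (Γ : Graph) (G q : List (Graph.V Γ))
          → (List (Maybe (Graph.V Γ)) → Carrier) → (List (Graph.V Γ) → Carrier)
  permAct Γ G q y w =
    sumF (map (λ u → if does (decOrd Γ (substOrd q u) w) then y u else 0#)
              (perms (Graph.vs (contract Γ G))))

  record PermFreeOverPlanEq : Set (lsuc 0ℓ ⊔ c ⊔ ℓ) where
    field
      ψ : (Γ : Graph) → Connected Γ → LinMap (HPBasis Γ) (PermBasis Γ)
      φ : (Γ : Graph) → Connected Γ → LinMap (PermBasis Γ) (HPBasis Γ)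
      ψφ : ∀ Γ cΓ x → EqOn (PermBasis Γ) (app (ψ Γ cΓ) (app (φ Γ cΓ) x)) x
      φψ : ∀ Γ cΓ x → EqOn (HPBasis Γ) (app (φ Γ cΓ) (app (ψ Γ cΓ) x)) x
      natural : ∀ Γ Δ (cΓ : Connected Γ) (cΔ : Connected Δ) (σ : GraphIso Γ Δ)
                  (x : List (List (Graph.V Γ)) → Carrier) →
                EqOn (PermBasis Δ)
                  (app (ψ Δ cΔ) (λ b → x (map (map (GraphIso.from σ)) b)))
                  (λ w → app (ψ Γ cΓ) x (map (GraphIso.from σ) w))
      module-map : ∀ Γ (cΓ : Connected Γ) (G : List (Graph.V Γ)) → T (GraphOps.isTube Γ G)
                   → (cG : Connected (contract Γ G))
                   → (q : List (Graph.V Γ)) → T (GraphOps.isOrderingOf Γ G q ∧ GraphOps.isPlanEq Γ q)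
                   → (b : List (List (Maybe (Graph.V Γ)))) → T (HPBasis (contract Γ G) b)
                   → EqOn (PermBasis Γ)
                       (app (ψ Γ cΓ) (δ (decHP Γ) (map (substOrd q) b)))
                       (permAct Γ G q (app (ψ (contract Γ G) cG) (δ (decHP (contract Γ G)) b)))

{-# OPTIONS --safe #-}

-- Every ordering of the vertices of Γ factors uniquely as a concatenation B₁ ⋯ Bₖ of planar
-- tubes (tubes carrying a Γ-admissible planar binary tree) in which no union Bᵢ ∪ Bᵢ₊₁ is a
-- tube, i.e. as a basis element of (Ham-bar ∘ PlanEq)(Γ). Such a factorisation is found by
-- merging greedily from the right. It is unique because a planar tube never straddles a block
-- boundary: by induction on its tree, the two subtrees at the root would otherwise lie in the
-- two adjacent blocks and glue them into a tube. So concatenation is a bijection of bases,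
-- visibly natural in graph isomorphisms. It commutes with the right PlanEq-action since
-- substituting a planar ordering q of a tube G for the vertex {G} is injective and matches the
-- tubes of Γ/G with the tubes of Γ that are unions of fibres; hence it carries chains of Γ/G to
-- chains of Γ, and exactly one term of the sum defining the action survives.

module Submission where

open import Defs
open import Level using (Level)
open import Function using (_∘_; Equivalence)
open import Data.Bool using (Bool; true; false; _∧_; _∨_; not; T; if_then_else_)
open import Data.Bool.Properties using (T-∧; T-∨; T?)
open import Data.Bool.ListAction using (all; any)
open import Data.Empty using (⊥; ⊥-elim)
open import Data.Unit using (tt)
open import Data.Nat using (ℕ; zero; suc; _+_; _≤_; _<_; z≤n; s≤s; _≤′_; ≤′-refl; ≤′-step)
open import Data.Nat.Properties
  using (suc-injective; ≤-refl; ≤-trans; m≤n⇒m≤1+n; n≤1+n; <-irrefl; ≤⇒≤′)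
open import Data.Product using (∃-syntax; _×_; _,_; proj₁; proj₂)
open import Data.Sum using (_⊎_; inj₁; inj₂)
open import Data.Maybe using (Maybe; just; nothing)
open import Data.List
  using (List; []; _∷_; [_]; _∷ʳ_; initLast; _∷ʳ′_; _++_; map; concat; concatMap; length; filterᵇ)
import Data.List.Properties as List
open import Data.List.Membership.Propositional using (_∈_; _∉_; find)
open import Data.List.Membership.Propositional.Properties
  using (∈-++⁺ˡ; ∈-++⁺ʳ; ∈-++⁻; ∈-map⁺; ∈-map⁻; ∈-filter⁺; ∈-filter⁻; ∈-∃++;
         ∈-concat⁻; ∈-concat⁺′)
open import Data.List.Relation.Binary.Subset.Propositional using (_⊆_)
open import Data.List.Relation.Binary.Subset.Propositional.Properties
  using (⊆-refl; ⊆-trans; xs⊆xs++ys; xs⊆ys++xs; ++⁺; ∷⁺ʳ)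
open import Data.List.Relation.Unary.Any as Any using (here; there)
open import Data.List.Relation.Unary.Any.Properties
  using (any⁺; any⁻) renaming (map⁻ to Any-map⁻)
open import Data.List.Relation.Unary.All as All using (All; []; _∷_)
open import Data.List.Relation.Unary.All.Properties
  using (all⁺; all⁻; ¬All⇒Any¬) renaming (map⁺ to All-map⁺)
open import Data.List.Relation.Unary.AllPairs using ([]; _∷_)
open import Data.List.Relation.Unary.Unique.Propositional using (Unique)
open import Relation.Binary using (DecidableEquality)
open import Relation.Binary.Construct.Closure.ReflexiveTransitive as Star using (Star; ε; _◅_; _◅◅_)
open import Relation.Binary.PropositionalEquality
  using (_≡_; _≢_; refl; sym; trans; cong; cong₂; subst; module ≡-Reasoning)
open import Relation.Nullary using (¬_; does; yes; no)

T-∧⁻ : ∀ {a b} → T (a ∧ b) → T a × T b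
T-∧⁻ = Equivalence.to T-∧

T-∧⁺ : ∀ {a b} → T a → T b → T (a ∧ b)
T-∧⁺ p q = Equivalence.from T-∧ (p , q)

T-not⁻ : ∀ {a} → T (not a) → ¬ T a
T-not⁻ {true}  ()
T-not⁻ {false} _ ()

T-not⁺ : ∀ {a} → ¬ T a → T (not a)
T-not⁺ {true}  ¬t = ¬t tt
T-not⁺ {false} _  = tt

T-⇔⇒≡ : ∀ {a b} → (T a → T b) → (T b → T a) → a ≡ b
T-⇔⇒≡ {true}  {true}  _ _ = refl
T-⇔⇒≡ {true}  {false} f _ = ⊥-elim (f tt)
T-⇔⇒≡ {false} {true}  _ g = ⊥-elim (g tt)
T-⇔⇒≡ {false} {false} _ _ = refl

module _ {A : Set} where

  ++-≡-++ : (a b c d : List A) → a ++ b ≡ c ++ d →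
            (∃[ m ] c ≡ a ++ m × b ≡ m ++ d) ⊎ (∃[ n ] a ≡ c ++ n × d ≡ n ++ b)
  ++-≡-++ []      b c       d eq = inj₁ (c , refl , eq)
  ++-≡-++ (x ∷ a) b []      d eq = inj₂ (x ∷ a , refl , sym eq)
  ++-≡-++ (x ∷ a) b (y ∷ c) d eq with List.∷-injective eq
  ... | refl , eq′ with ++-≡-++ a b c d eq′
  ...   | inj₁ (m , c≡ , b≡) = inj₁ (m , cong (x ∷_) c≡ , b≡)
  ...   | inj₂ (n , a≡ , d≡) = inj₂ (n , cong (x ∷_) a≡ , d≡)

  length-filterᵇ-≤ : (p q : A → Bool) (L : List A) → (∀ {y} → y ∈ L → T (p y) → T (q y)) →
                     length (filterᵇ p L) ≤ length (filterᵇ q L)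
  length-filterᵇ-≤ p q []      p⇒q = z≤n
  length-filterᵇ-≤ p q (y ∷ L) p⇒q with p y in py | q y in qy
  ... | true  | true  = s≤s (length-filterᵇ-≤ p q L (p⇒q ∘ there))
  ... | true  | false = ⊥-elim (subst T qy (p⇒q (here refl) (subst T (sym py) tt)))
  ... | false | true  = m≤n⇒m≤1+n (length-filterᵇ-≤ p q L (p⇒q ∘ there))
  ... | false | false = length-filterᵇ-≤ p q L (p⇒q ∘ there)

  length-filterᵇ-< : (p q : A → Bool) (L : List A) → (∀ {y} → y ∈ L → T (p y) → T (q y)) →
                     ∀ {x} → x ∈ L → T (q x) → ¬ T (p x) → length (filterᵇ p L) < length (filterᵇ q L)
  length-filterᵇ-< p q (y ∷ L) p⇒q x∈ qx ¬px with p y in py | q y in qy | x∈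
  ... | true  | false | _         = ⊥-elim (subst T qy (p⇒q (here refl) (subst T (sym py) tt)))
  ... | true  | true  | here refl = ⊥-elim (¬px (subst T (sym py) tt))
  ... | true  | true  | there x∈′ = s≤s (length-filterᵇ-< p q L (p⇒q ∘ there) x∈′ qx ¬px)
  ... | false | true  | _         = s≤s (length-filterᵇ-≤ p q L (p⇒q ∘ there))
  ... | false | false | here refl = ⊥-elim (subst T qy qx)
  ... | false | false | there x∈′ = length-filterᵇ-< p q L (p⇒q ∘ there) x∈′ qx ¬px

  ++-⊆ : ∀ {xs ys zs : List A} → xs ⊆ zs → ys ⊆ zs → xs ++ ys ⊆ zs
  ++-⊆ {xs} xs⊆ ys⊆ v∈ with ∈-++⁻ xs v∈
  ... | inj₁ v∈xs = xs⊆ v∈xs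
  ... | inj₂ v∈ys = ys⊆ v∈ys

  concat-∷ʳ : ∀ (c : List (List A)) B → concat (c ∷ʳ B) ≡ concat c ++ B
  concat-∷ʳ c B = trans (sym (List.concat-++ c [ B ])) (cong (concat c ++_) (List.++-identityʳ B))

  singleton-≢-++ : ∀ {x : A} {L R} → [ x ] ≡ L ++ R → L ≢ [] → R ≢ [] → ⊥
  singleton-≢-++ {L = []}    _ L≢[] _    = L≢[] refl
  singleton-≢-++ {L = _ ∷ L} e _    R≢[] = R≢[] (List.++-conicalʳ L _ (sym (List.∷-injectiveʳ e)))

  ++-head : ∀ (xs : List A) {ys z zs} → xs ≢ [] → xs ++ ys ≡ z ∷ zs → z ∈ xs
  ++-head []      xs≢[] _ = ⊥-elim (xs≢[] refl)
  ++-head (x ∷ _) _     e = here (sym (List.∷-injectiveˡ e))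

  ∈-substOrd⁻ : ∀ {q : List A} B {x} → x ∈ substOrd q B → ∃[ α ] α ∈ B × x ∈ substVertex q α
  ∈-substOrd⁻ {q} B x∈ = find (Any-map⁻ (∈-concat⁻ (map (substVertex q) B) x∈))

  ∈-substOrd⁺ : ∀ {q : List A} {B α x} → α ∈ B → x ∈ substVertex q α → x ∈ substOrd q B
  ∈-substOrd⁺ {q} α∈ x∈ = ∈-concat⁺′ x∈ (∈-map⁺ (substVertex q) α∈)

  substOrd-++ : ∀ (q : List A) B B′ → substOrd q (B ++ B′) ≡ substOrd q B ++ substOrd q B′
  substOrd-++ q = List.concatMap-++ (substVertex q)

  concat-map-substOrd : ∀ (q : List A) b → concat (map (substOrd q) b) ≡ substOrd q (concat b)
  concat-map-substOrd q []      = refl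
  concat-map-substOrd q (B ∷ b) =
    trans (cong (substOrd q B ++_) (concat-map-substOrd q b)) (sym (substOrd-++ q B (concat b)))

module GraphTheory (Γ : Graph) where
  open Graph Γ
  open GraphOps Γ

  ≟-sound : ∀ {u v} → T (does (u ≟ v)) → u ≡ v
  ≟-sound {u} {v} t with u ≟ v
  ... | yes u≡v = u≡v

  ≟-refl : ∀ {v} → T (does (v ≟ v))
  ≟-refl {v} with v ≟ v
  ... | yes _  = tt
  ... | no v≢v = v≢v refl

  ∈ᵇ⇒∈ : ∀ {v} xs → T (v ∈ᵇ xs) → v ∈ xs
  ∈ᵇ⇒∈ xs t = Any.map (sym ∘ ≟-sound) (any⁻ _ xs t)

  ∈⇒∈ᵇ : ∀ {v xs} → v ∈ xs → T (v ∈ᵇ xs)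
  ∈⇒∈ᵇ v∈ = any⁺ _ (Any.map (λ { refl → ≟-refl }) v∈)

  ⊆ᵇ⇒⊆ : ∀ xs ys → T (xs ⊆ᵇ ys) → xs ⊆ ys
  ⊆ᵇ⇒⊆ xs ys t = ∈ᵇ⇒∈ ys ∘ All.lookup (all⁺ _ xs t)

  ⊆⇒⊆ᵇ : ∀ {xs ys} → xs ⊆ ys → T (xs ⊆ᵇ ys)
  ⊆⇒⊆ᵇ xs⊆ys = all⁻ _ (All.tabulate (∈⇒∈ᵇ ∘ xs⊆ys))

  uniqueᵇ⇒Unique : ∀ w → T (uniqueᵇ w) → Unique w
  uniqueᵇ⇒Unique []      _ = []
  uniqueᵇ⇒Unique (x ∷ w) t with T-∧⁻ {not (x ∈ᵇ w)} t
  ... | x∉w , uw =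
    All.tabulate (λ { y∈w refl → T-not⁻ x∉w (∈⇒∈ᵇ y∈w) }) ∷ uniqueᵇ⇒Unique w uw

  isOrderingOf⇒⊆ : ∀ S w → T (isOrderingOf S w) → w ⊆ S × S ⊆ w
  isOrderingOf⇒⊆ S w t with T-∧⁻ (proj₂ (T-∧⁻ {uniqueᵇ w} t))
  ... | w⊆S , S⊆w = ⊆ᵇ⇒⊆ w S w⊆S , ⊆ᵇ⇒⊆ S w S⊆w

  -- Paths, tubes and breadth-first search

  adjacent-sym : ∀ {x y} → T (adj x y) → T (adj y x)
  adjacent-sym {x} {y} = subst T (adj-sym x y)

  Edge : List V → V → V → Set
  Edge S x y = x ∈ S × y ∈ S × T (adj x y)

  Path : List V → V → V → Set
  Path S = Star (Edge S)

  reverse : ∀ {S x y} → Path S x y → Path S y x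
  reverse = Star.reverse (λ (x∈ , y∈ , a) → y∈ , x∈ , adjacent-sym a)

  path-mono : ∀ {S S′ x y} → S ⊆ S′ → Path S x y → Path S′ x y
  path-mono S⊆S′ = Star.map (λ (x∈ , y∈ , a) → S⊆S′ x∈ , S⊆S′ y∈ , a)

  ConnectedOn : List V → Set
  ConnectedOn S = ∀ {x y} → x ∈ S → y ∈ S → Path S x y

  record Tube (S : List V) : Set where
    constructor tube
    field
      inhabited : ∃[ x ] x ∈ S
      ⊆vs       : S ⊆ vs
      connected : ConnectedOn S
  open Tube public

  tube-≐ : ∀ {A B} → Tube A → A ⊆ B → B ⊆ A → Tube B
  tube-≐ (tube (x , x∈) A⊆vs conn) A⊆B B⊆A =
    tube (x , A⊆B x∈) (A⊆vs ∘ B⊆A) (λ x∈ y∈ → path-mono A⊆B (conn (B⊆A x∈) (B⊆A y∈)))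

  tube-++ : ∀ {A B z} → Tube A → Tube B → z ∈ A → z ∈ B → Tube (A ++ B)
  tube-++ {A} {B} {z} (tube (x , x∈) A⊆vs connA) (tube _ B⊆vs connB) z∈A z∈B =
    tube (x , ∈-++⁺ˡ x∈) (++-⊆ A⊆vs B⊆vs) (λ x∈ y∈ → to-z x∈ ◅◅ reverse (to-z y∈))
    where
    to-z : ∀ {x} → x ∈ A ++ B → Path (A ++ B) x z
    to-z x∈ with ∈-++⁻ A x∈
    ... | inj₁ x∈A = path-mono (xs⊆xs++ys A B) (connA x∈A z∈A)
    ... | inj₂ x∈B = path-mono (xs⊆ys++xs B A) (connB x∈B z∈B)

  tube-bridge : ∀ {A B M x y} → Tube A → Tube B → Tube M → M ⊆ A ++ B →
                x ∈ A → x ∈ M → y ∈ M → y ∈ B → Tube (A ++ B)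
  tube-bridge {A} {B} {M} tA tB tM M⊆ x∈A x∈M y∈M y∈B =
    tube-≐ (tube-++ (tube-++ tA tM x∈A x∈M) tB (∈-++⁺ʳ A y∈M) y∈B)
           (++-⊆ (++-⊆ (xs⊆xs++ys A B) M⊆) (xs⊆ys++xs B A))
           (++⁺ (xs⊆xs++ys A M) ⊆-refl)

  singleton-tube : ∀ {v} → v ∈ vs → Tube [ v ]
  singleton-tube v∈ = tube (_ , here refl) (λ { (here refl) → v∈ }) (λ { (here refl) (here refl) → ε })

  Frontier : List V → V → Set
  Frontier R x = x ∈ R ⊎ ∃[ u ] u ∈ R × T (adj u x)

  inFrontier : List V → V → Bool
  inFrontier R v = (v ∈ᵇ R) ∨ any (λ u → adj u v) R

  bfsStep⁻ : ∀ S R {x} → x ∈ bfsStep S R → x ∈ S × Frontier R x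
  bfsStep⁻ S R x∈ with ∈-filter⁻ (T? ∘ inFrontier R) x∈
  ... | x∈S , t with Equivalence.to T-∨ t
  ...   | inj₁ x∈R  = x∈S , inj₁ (∈ᵇ⇒∈ R x∈R)
  ...   | inj₂ adjR = x∈S , inj₂ (find (any⁻ _ R adjR))

  bfsStep⁺ : ∀ S R {x} → x ∈ S → Frontier R x → x ∈ bfsStep S R
  bfsStep⁺ S R x∈S fr = ∈-filter⁺ (T? ∘ inFrontier R) x∈S (Equivalence.from T-∨ (go fr))
    where
    go : ∀ {x} → Frontier R x → T (x ∈ᵇ R) ⊎ T (any (λ u → adj u x) R)
    go (inj₁ x∈R)            = inj₁ (∈⇒∈ᵇ x∈R)
    go (inj₂ (u , u∈R , a)) = inj₂ (any⁺ _ (Any.map (λ { refl → a }) u∈R))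

  reach-suc : ∀ n S R → reach (suc n) S R ≡ bfsStep S (reach n S R)
  reach-suc zero    S R = refl
  reach-suc (suc n) S R = reach-suc n S (bfsStep S R)

  reach-sound : ∀ {S s} n R → R ⊆ S → (∀ {x} → x ∈ R → Path S s x) →
                ∀ {x} → x ∈ reach n S R → Path S s x
  reach-sound         zero    R R⊆S paths = paths
  reach-sound {S} {s} (suc n) R R⊆S paths = reach-sound n (bfsStep S R) (proj₁ ∘ bfsStep⁻ S R) extend
    where
    extend : ∀ {x} → x ∈ bfsStep S R → Path S s x
    extend x∈ with bfsStep⁻ S R x∈
    ... | _   , inj₁ x∈R            = paths x∈R
    ... | x∈S , inj₂ (u , u∈R , a) = paths u∈R ◅◅ (R⊆S u∈R , x∈S , a) ◅ ε

  module BreadthFirstSearch (S : List V) {s : V} (s∈S : s ∈ S) where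
    open import Data.List.Membership.DecPropositional _≟_ using (_∈?_)

    reached : ℕ → List V
    reached k = reach k S [ s ]

    reached-suc : ∀ k → reached (suc k) ≡ bfsStep S (reached k)
    reached-suc k = reach-suc k S [ s ]

    reached⊆S : ∀ k → reached k ⊆ S
    reached⊆S zero    (here refl) = s∈S
    reached⊆S (suc k) x∈ rewrite reached-suc k = proj₁ (bfsStep⁻ S (reached k) x∈)

    reached-step : ∀ k → reached k ⊆ reached (suc k)
    reached-step k x∈ rewrite reached-suc k = bfsStep⁺ S (reached k) (reached⊆S k x∈) (inj₁ x∈)

    reached-mono : ∀ {j k} → j ≤ k → reached j ⊆ reached k
    reached-mono = go ∘ ≤⇒≤′
      where
      go : ∀ {j k} → j ≤′ k → reached j ⊆ reached k
      go ≤′-refl             = ⊆-refl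
      go (≤′-step {k} j≤k) = reached-step k ∘ go j≤k

    Stable : ℕ → Set
    Stable j = reached (suc j) ⊆ reached j

    stable-closed : ∀ j → Stable j → ∀ {y x} → Path S y x → y ∈ reached j → x ∈ reached j
    stable-closed j st ε                    y∈ = y∈
    stable-closed j st ((_ , z∈S , a) ◅ p) y∈ =
      stable-closed j st p (st (subst (_ ∈_) (sym (reached-suc j))
                                      (bfsStep⁺ S (reached j) z∈S (inj₂ (_ , y∈ , a)))))

    size : ℕ → ℕ
    size k = length (filterᵇ (_∈ᵇ reached k) S)

    grows-or-stabilises : ∀ k → suc k ≤ size k ⊎ ∃[ j ] j ≤ k × Stable j
    grows-or-stabilises zero =
      inj₁ (≤-trans (s≤s z≤n) (length-filterᵇ-< (λ _ → false) (_∈ᵇ reached 0) S (λ _ ())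
                                                 s∈S (∈⇒∈ᵇ {xs = [ s ]} (here refl)) (λ ())))
    grows-or-stabilises (suc k) with grows-or-stabilises k
    ... | inj₂ (j , j≤k , st) = inj₂ (j , m≤n⇒m≤1+n j≤k , st)
    ... | inj₁ k<size with All.all? (_∈? reached k) (reached (suc k))
    ...   | yes new⊆old = inj₂ (k , n≤1+n k , All.lookup new⊆old)
    ...   | no ¬new⊆old with find (¬All⇒Any¬ (_∈? reached k) (reached (suc k)) ¬new⊆old)
    ...     | x , x∈new , x∉old = inj₁ (≤-trans (s≤s k<size)
                (length-filterᵇ-< (_∈ᵇ reached k) (_∈ᵇ reached (suc k)) S
                   (λ _ → ∈⇒∈ᵇ ∘ reached-step k ∘ ∈ᵇ⇒∈ _)
                   (reached⊆S (suc k) x∈new) (∈⇒∈ᵇ x∈new) (x∉old ∘ ∈ᵇ⇒∈ _)))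

    reach-complete : ∀ {x} → Path S s x → x ∈ reached (length S)
    reach-complete p with grows-or-stabilises (length S)
    ... | inj₁ S<size =
      ⊥-elim (<-irrefl refl (≤-trans S<size (List.length-filter (T? ∘ (_∈ᵇ reached (length S))) S)))
    ... | inj₂ (j , j≤ , st) = reached-mono j≤ (stable-closed j st p (reached-mono {0} {j} z≤n (here refl)))

  isConnectedSet⇒ : ∀ S → T (isConnectedSet S) → (∃[ x ] x ∈ S) × ConnectedOn S
  isConnectedSet⇒ (s ∷ S) t = (s , here refl) , λ x∈ y∈ → reverse (from-s x∈) ◅◅ from-s y∈
    where
    from-s : ∀ {x} → x ∈ s ∷ S → Path (s ∷ S) s x
    from-s x∈ = reach-sound (length (s ∷ S)) [ s ] (λ { (here refl) → here refl }) (λ { (here refl) → ε })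
                  (⊆ᵇ⇒⊆ (s ∷ S) _ t x∈)

  isConnectedSet⇐ : ∀ {S} → ∃[ x ] x ∈ S → ConnectedOn S → T (isConnectedSet S)
  isConnectedSet⇐ {s ∷ S} _ conn =
    ⊆⇒⊆ᵇ (λ x∈ → BreadthFirstSearch.reach-complete (s ∷ S) (here refl) (conn (here refl) x∈))

  isTube⇒Tube : ∀ S → T (isTube S) → Tube S
  isTube⇒Tube S t with T-∧⁻ {S ⊆ᵇ vs} t
  ... | S⊆vs , conn with isConnectedSet⇒ S conn
  ...   | inh , connected = tube inh (⊆ᵇ⇒⊆ S vs S⊆vs) connected

  Tube⇒isTube : ∀ {S} → Tube S → T (isTube S)
  Tube⇒isTube (tube inh S⊆vs conn) = T-∧⁺ (⊆⇒⊆ᵇ S⊆vs) (isConnectedSet⇐ inh conn)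

  -- Planar binary trees and chains of planar tubes

  data Planar : List V → Set where
    leaf : ∀ x → Planar [ x ]
    node : ∀ {L R} → T (isTube L) → T (isTube R) → Planar L → Planar R → Planar (L ++ R)

  splits-sound : ∀ w {L R} → (L , R) ∈ splits w → w ≡ L ++ R
  splits-sound (x ∷ y ∷ xs) (here refl) = refl
  splits-sound (x ∷ y ∷ xs) (there p∈) with ∈-map⁻ _ p∈
  ... | _ , p∈′ , refl = cong (x ∷_) (splits-sound (y ∷ xs) p∈′)

  splits-complete : ∀ a L r R → (a ∷ L , r ∷ R) ∈ splits ((a ∷ L) ++ (r ∷ R))
  splits-complete a []      r R = here refl
  splits-complete a (b ∷ L) r R = there (∈-map⁺ _ (splits-complete b L r R))

  planTree⇒Planar : ∀ n w → T (planTree n w) → Planar w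
  planTree⇒Planar n       (x ∷ [])     _ = leaf x
  planTree⇒Planar (suc n) (x ∷ y ∷ xs) t with find (any⁻ _ (splits (x ∷ y ∷ xs)) t)
  ... | (L , R) , p∈ , t with T-∧⁻ {isTube L} t
  ...   | tL , t′ with T-∧⁻ {isTube R} t′
  ...     | tR , t″ with T-∧⁻ {planTree n L} t″
  ...       | pL , pR = subst Planar (sym (splits-sound (x ∷ y ∷ xs) p∈))
                          (node tL tR (planTree⇒Planar n L pL) (planTree⇒Planar n R pR))

  planTree-split : ∀ n w {L R} → (L , R) ∈ splits w →
                   T (isTube L ∧ isTube R ∧ planTree n L ∧ planTree n R) → T (planTree (suc n) w)
  planTree-split n (x ∷ y ∷ xs) p∈ t = any⁺ _ (Any.map (λ { refl → t }) p∈)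

  Planar⇒planTree : ∀ {w} → Planar w → ∀ n → length w ≤ n → T (planTree n w)
  Planar⇒planTree (leaf x) n _ = tt
  Planar⇒planTree (node {[]} () _ _ _)
  Planar⇒planTree (node {_ ∷ _} {[]} _ () _ _)
  Planar⇒planTree (node {a ∷ L} {r ∷ R} tL tR pL pR) (suc n) (s≤s |w|≤n) =
    planTree-split n ((a ∷ L) ++ (r ∷ R)) (splits-complete a L r R)
      (T-∧⁺ tL (T-∧⁺ tR (T-∧⁺ (Planar⇒planTree pL n (≤-trans |L|<|w| |w|≤n))
                              (Planar⇒planTree pR n (≤-trans (List.length-++-≤ʳ (r ∷ R) {L}) |w|≤n)))))
    where
    |L|<|w| : length L < length (L ++ r ∷ R)
    |L|<|w| = subst (length L <_) (sym (List.length-++-sucʳ L r R)) (s≤s (List.length-++-≤ˡ L))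

  PlanarTube : List V → Set
  PlanarTube B = T (isTube B) × Planar B

  planarTube-nonempty : ∀ {B} → PlanarTube B → B ≢ []
  planarTube-nonempty (t , _) refl = t

  isPlanEq⇒PlanarTube : ∀ B → T (isPlanEq B) → PlanarTube B
  isPlanEq⇒PlanarTube B t with T-∧⁻ {isTube B} t
  ... | tB , pB = tB , planTree⇒Planar (length B) B pB

  PlanarTube⇒isPlanEq : ∀ {B} → PlanarTube B → T (isPlanEq B)
  PlanarTube⇒isPlanEq {B} (tB , pB) = T-∧⁺ tB (Planar⇒planTree pB (length B) ≤-refl)

  record Chain (c : List (List V)) : Set where
    constructor chain
    field
      blocks    : All PlanarTube c
      separated : T (consecutiveNonAdj c)

  separated-tail : ∀ B c → T (consecutiveNonAdj (B ∷ c)) → T (consecutiveNonAdj c)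
  separated-tail B []       _ = tt
  separated-tail B (B′ ∷ c) t = proj₂ (T-∧⁻ {not (isTube (B ++ B′))} t)

  separated-junction : ∀ c₁ B B′ c₂ → T (consecutiveNonAdj (c₁ ++ B ∷ B′ ∷ c₂)) →
                       ¬ T (isTube (B ++ B′))
  separated-junction []        B B′ c₂ t = T-not⁻ (proj₁ (T-∧⁻ {not (isTube (B ++ B′))} t))
  separated-junction (B₀ ∷ c₁) B B′ c₂ t =
    separated-junction c₁ B B′ c₂ (separated-tail B₀ (c₁ ++ B ∷ B′ ∷ c₂) t)

  chain-tail : ∀ {B c} → Chain (B ∷ c) → Chain c
  chain-tail {B} {c} (chain (_ ∷ blocks) sep) = chain blocks (separated-tail B c sep)

  isHamPlan⇒Chain : ∀ c → T (isHamPlan c) → T (isOrdering (concat c)) × Chain c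
  isHamPlan⇒Chain c t with T-∧⁻ {isOrdering (concat c)} t
  ... | ord , t′ with T-∧⁻ {all isTube c} t′
  ...   | _ , t″ with T-∧⁻ {all isPlanEq c} t″
  ...     | planEq , sep = ord , chain (All.map (isPlanEq⇒PlanarTube _) (all⁺ _ c planEq)) sep

  Chain⇒isHamPlan : ∀ c → T (isOrdering (concat c)) → Chain c → T (isHamPlan c)
  Chain⇒isHamPlan c ord (chain blocks sep) =
    T-∧⁺ ord (T-∧⁺ (all⁻ _ (All.map proj₁ blocks))
                   (T-∧⁺ (all⁻ _ (All.map PlanarTube⇒isPlanEq blocks)) sep))

  merge : List V → List (List V) → List (List V)
  merge B []       = [ B ]
  merge B (B′ ∷ c) = if isTube (B ++ B′) then merge (B ++ B′) c else B ∷ B′ ∷ c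

  decompose : List V → List (List V)
  decompose []      = []
  decompose (v ∷ w) = merge [ v ] (decompose w)

  concat-merge : ∀ B c → concat (merge B c) ≡ B ++ concat c
  concat-merge B []       = refl
  concat-merge B (B′ ∷ c) with isTube (B ++ B′)
  ... | true  = trans (concat-merge (B ++ B′) c) (List.++-assoc B B′ (concat c))
  ... | false = refl

  concat-decompose : ∀ w → concat (decompose w) ≡ w
  concat-decompose []      = refl
  concat-decompose (v ∷ w) = trans (concat-merge [ v ] (decompose w)) (cong (v ∷_) (concat-decompose w))

  merge-chain : ∀ {B c} → PlanarTube B → Chain c → Chain (merge B c)
  merge-chain {B} {[]}     pB _ = chain (pB ∷ []) tt
  merge-chain {B} {B′ ∷ c} (tB , pB) (chain ((tB′ , pB′) ∷ blocks) sep) with isTube (B ++ B′) in merges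
  ... | true  = merge-chain (subst T (sym merges) tt , node tB tB′ pB pB′)
                            (chain blocks (separated-tail B′ c sep))
  ... | false = chain ((tB , pB) ∷ (tB′ , pB′) ∷ blocks) (T-∧⁺ (subst (T ∘ not) (sym merges) tt) sep)

  decompose-chain : ∀ {w} → w ⊆ vs → Chain (decompose w)
  decompose-chain {[]}    _    = chain [] tt
  decompose-chain {v ∷ w} w⊆vs =
    merge-chain (Tube⇒isTube (singleton-tube (w⊆vs (here refl))) , leaf v) (decompose-chain (w⊆vs ∘ there))

  module _ {C : List (List V)} (C-chain : Chain C) where
    open Chain C-chain

    record Straddle (U : List V) : Set where
      constructor straddle
      field
        before after : List (List V)
        cut          : C ≡ before ++ after
        X L R Y      : List V
        left         : concat before ≡ X ++ L
        right        : concat after ≡ R ++ Y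
        split        : U ≡ L ++ R
        L≢[]         : L ≢ []
        R≢[]         : R ≢ []

    block-tube : ∀ {B} → B ∈ C → Tube B
    block-tube B∈ = isTube⇒Tube _ (proj₁ (All.lookup blocks B∈))

    ends-in-last-block : ∀ {L} ci Bl after X → ¬ Straddle L → C ≡ (ci ∷ʳ Bl) ++ after →
                         concat (ci ∷ʳ Bl) ≡ X ++ L → L ⊆ Bl
    ends-in-last-block {L} ci Bl after X ¬straddle cut left
      with ++-≡-++ (concat ci) Bl X L (trans (sym (concat-∷ʳ ci Bl)) left)
    ... | inj₁ (m , _ , Bl≡)          = subst (L ⊆_) (sym Bl≡) (xs⊆ys++xs L m)
    ... | inj₂ ([] , _ , L≡)          = subst (_⊆ Bl) (sym L≡) ⊆-refl
    ... | inj₂ (n@(_ ∷ _) , ci≡ , L≡) = ⊥-elim (¬straddle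
          (straddle ci (Bl ∷ after) (trans cut (List.++-assoc ci [ Bl ] after)) X n Bl (concat after)
                    ci≡ refl L≡ (λ ()) (planarTube-nonempty (All.lookup blocks Bl∈))))
      where
      Bl∈ : Bl ∈ C
      Bl∈ = subst (Bl ∈_) (sym cut) (∈-++⁺ˡ (∈-++⁺ʳ ci (here refl)))

    starts-in-first-block : ∀ {R} before Bf after Y → ¬ Straddle R → C ≡ before ++ Bf ∷ after →
                            Bf ++ concat after ≡ R ++ Y → R ⊆ Bf
    starts-in-first-block {R} before Bf after Y ¬straddle cut right
      with ++-≡-++ Bf (concat after) R Y right
    ... | inj₂ (n , Bf≡ , _)             = subst (R ⊆_) (sym Bf≡) (xs⊆xs++ys R n)
    ... | inj₁ ([] , R≡ , _)             = subst (_⊆ Bf) (sym (trans R≡ (List.++-identityʳ Bf))) ⊆-refl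
    ... | inj₁ (m@(_ ∷ _) , R≡ , after≡) = ⊥-elim (¬straddle
          (straddle (before ∷ʳ Bf) after (trans cut (sym (List.++-assoc before [ Bf ] after)))
                    (concat before) Bf m Y (concat-∷ʳ before Bf) after≡ R≡
                    (planarTube-nonempty (All.lookup blocks Bf∈)) (λ ())))
      where
      Bf∈ : Bf ∈ C
      Bf∈ = subst (Bf ∈_) (sym cut) (∈-++⁺ʳ before (here refl))

    no-straddle-at-root : ∀ {L R} → T (isTube (L ++ R)) → PlanarTube L → PlanarTube R →
                          ¬ Straddle L → ¬ Straddle R →
                          ∀ before after X Y → C ≡ before ++ after →
                          concat before ≡ X ++ L → concat after ≡ R ++ Y → ⊥
    no-straddle-at-root {L} {R} tLR pL pR ¬sL ¬sR before after X Y cut left right with initLast before | after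
    ... | []          | _ = planarTube-nonempty pL (List.++-conicalʳ X L (sym left))
    ... | _ ∷ʳ′ _     | [] = planarTube-nonempty pR (List.++-conicalˡ _ Y (sym right))
    ... | ci ∷ʳ′ Bl   | Bf ∷ after′ =
      separated-junction ci Bl Bf after′ (subst (T ∘ consecutiveNonAdj) junction separated)
        (Tube⇒isTube (tube-bridge (block-tube Bl∈) (block-tube Bf∈) (isTube⇒Tube _ tLR) (++⁺ L⊆Bl R⊆Bf)
                                  (L⊆Bl x∈L) (∈-++⁺ˡ x∈L) (∈-++⁺ʳ L y∈R) (R⊆Bf y∈R)))
      where
      junction : C ≡ ci ++ Bl ∷ Bf ∷ after′
      junction = trans cut (List.++-assoc ci [ Bl ] (Bf ∷ after′))
      Bl∈ : Bl ∈ C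
      Bl∈ = subst (Bl ∈_) (sym junction) (∈-++⁺ʳ ci (here refl))
      Bf∈ : Bf ∈ C
      Bf∈ = subst (Bf ∈_) (sym junction) (∈-++⁺ʳ ci (there (here refl)))
      L⊆Bl : L ⊆ Bl
      L⊆Bl = ends-in-last-block ci Bl (Bf ∷ after′) X ¬sL cut left
      R⊆Bf : R ⊆ Bf
      R⊆Bf = starts-in-first-block (ci ∷ʳ Bl) Bf after′ Y ¬sR cut right
      x∈L : proj₁ (inhabited (isTube⇒Tube L (proj₁ pL))) ∈ L
      x∈L = proj₂ (inhabited (isTube⇒Tube L (proj₁ pL)))
      y∈R : proj₁ (inhabited (isTube⇒Tube R (proj₁ pR))) ∈ R
      y∈R = proj₂ (inhabited (isTube⇒Tube R (proj₁ pR)))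

    no-straddle : ∀ {U} → T (isTube U) → Planar U → ¬ Straddle U
    no-straddle _ (leaf x) s = singleton-≢-++ split L≢[] R≢[]
      where open Straddle s
    no-straddle tU (node {L₀} {R₀} tL tR pL pR) s = by-cases (++-≡-++ L₀ R₀ L R split)
      where
      open Straddle s
      by-cases : (∃[ m ] L ≡ L₀ ++ m × R₀ ≡ m ++ R) ⊎ (∃[ n ] L₀ ≡ L ++ n × R ≡ n ++ R₀) → ⊥
      by-cases (inj₁ ([] , L≡ , R₀≡)) =
        no-straddle-at-root tU (tL , pL) (tR , pR) (no-straddle tL pL) (no-straddle tR pR) before after X Y cut
          (trans left (cong (X ++_) (trans L≡ (List.++-identityʳ L₀)))) (trans right (cong (_++ Y) (sym R₀≡)))
      by-cases (inj₂ ([] , L₀≡ , R≡)) =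
        no-straddle-at-root tU (tL , pL) (tR , pR) (no-straddle tL pL) (no-straddle tR pR) before after X Y cut
          (trans left (cong (X ++_) (sym (trans L₀≡ (List.++-identityʳ L))))) (trans right (cong (_++ Y) R≡))
      by-cases (inj₁ (m@(_ ∷ _) , L≡ , R₀≡)) = no-straddle tR pR
        (straddle before after cut (X ++ L₀) m R Y
                  (trans left (trans (cong (X ++_) L≡) (sym (List.++-assoc X L₀ m)))) right R₀≡ (λ ()) R≢[])
      by-cases (inj₂ (n@(_ ∷ _) , L₀≡ , R≡)) = no-straddle tL pL
        (straddle before after cut X L n (R₀ ++ Y)
                  left (trans right (trans (cong (_++ Y) R≡) (List.++-assoc n R₀ Y))) L₀≡ L≢[] (λ ()))

  chain-unique : ∀ {c c′} → Chain c → Chain c′ → concat c ≡ concat c′ → c ≡ c′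
  chain-unique {[]}    {[]}      _                  _                   e = refl
  chain-unique {[]}    {B′ ∷ c′} _                  (chain (pB′ ∷ _) _) e =
    ⊥-elim (planarTube-nonempty pB′ (List.++-conicalˡ B′ (concat c′) (sym e)))
  chain-unique {B ∷ c} {[]}      (chain (pB ∷ _) _) _                   e =
    ⊥-elim (planarTube-nonempty pB (List.++-conicalˡ B (concat c) e))
  chain-unique {B ∷ c} {B′ ∷ c′} ch@(chain (pB ∷ _) _) ch′@(chain (pB′ ∷ _) _) e
    with ++-≡-++ B (concat c) B′ (concat c′) e
  ... | inj₁ ([] , B′≡ , c≡) =
    cong₂ _∷_ (sym (trans B′≡ (List.++-identityʳ B))) (chain-unique (chain-tail ch) (chain-tail ch′) c≡)
  ... | inj₂ ([] , B≡ , c′≡) =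
    cong₂ _∷_ (trans B≡ (List.++-identityʳ B′)) (chain-unique (chain-tail ch) (chain-tail ch′) (sym c′≡))
  ... | inj₁ (m@(_ ∷ _) , B′≡ , c≡) = ⊥-elim (no-straddle ch (proj₁ pB′) (proj₂ pB′)
          (straddle [ B ] c refl [] B m (concat c′) (List.++-identityʳ B) c≡ B′≡
                    (planarTube-nonempty pB) (λ ())))
  ... | inj₂ (n@(_ ∷ _) , B≡ , c′≡) = ⊥-elim (no-straddle ch′ (proj₁ pB) (proj₂ pB)
          (straddle [ B′ ] c′ refl [] B′ n (concat c) (List.++-identityʳ B′) c′≡ B≡
                    (planarTube-nonempty pB′) (λ ())))

  isOrdering⇒⊆vs : ∀ w → T (isOrdering w) → w ⊆ vs
  isOrdering⇒⊆vs w = proj₁ ∘ isOrderingOf⇒⊆ vs w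

  decompose-isHamPlan : ∀ w → T (isOrdering w) → T (isHamPlan (decompose w))
  decompose-isHamPlan w ord =
    Chain⇒isHamPlan (decompose w) (subst (T ∘ isOrdering) (sym (concat-decompose w)) ord)
                    (decompose-chain (isOrdering⇒⊆vs w ord))

  decompose-concat : ∀ c → T (isHamPlan c) → decompose (concat c) ≡ c
  decompose-concat c hp with isHamPlan⇒Chain c hp
  ... | ord , ch = chain-unique (decompose-chain (isOrdering⇒⊆vs (concat c) ord)) ch (concat-decompose (concat c))

module TubeImage (Γ Δ : Graph) (f : Graph.V Γ → Graph.V Δ)
                 (f-vs : ∀ {x} → x ∈ Graph.vs Γ → f x ∈ Graph.vs Δ)
                 (f-adj : ∀ {x y} → x ∈ Graph.vs Γ → y ∈ Graph.vs Γ → T (Graph.adj Γ x y) →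
                          f x ≡ f y ⊎ T (Graph.adj Δ (f x) (f y))) where
  module Γ = GraphTheory Γ
  module Δ = GraphTheory Δ

  path-image : ∀ {S x y} → S ⊆ Graph.vs Γ → Γ.Path S x y → Δ.Path (map f S) (f x) (f y)
  path-image S⊆vs ε = ε
  path-image {S} {y = y} S⊆vs ((x∈ , z∈ , a) ◅ p) with f-adj (S⊆vs x∈) (S⊆vs z∈) a
  ... | inj₁ fx≡fz = subst (λ u → Δ.Path (map f S) u (f y)) (sym fx≡fz) (path-image S⊆vs p)
  ... | inj₂ a′    = (∈-map⁺ f x∈ , ∈-map⁺ f z∈ , a′) ◅ path-image S⊆vs p

  tube-image : ∀ {S} → Γ.Tube S → Δ.Tube (map f S)
  tube-image (Γ.tube (x , x∈) S⊆vs conn) = Δ.tube (f x , ∈-map⁺ f x∈) image⊆vs image-connected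
    where
    image⊆vs : map f _ ⊆ Graph.vs Δ
    image⊆vs u∈ with ∈-map⁻ f u∈
    ... | _ , x∈ , refl = f-vs (S⊆vs x∈)
    image-connected : Δ.ConnectedOn (map f _)
    image-connected u∈ v∈ with ∈-map⁻ f u∈ | ∈-map⁻ f v∈
    ... | _ , x∈ , refl | _ , y∈ , refl = path-image S⊆vs (conn x∈ y∈)

module Isomorphism {Γ Δ : Graph} (σ : GraphIso Γ Δ) where
  open GraphIso σ
  module Γ = GraphTheory Γ
  module Δ = GraphTheory Δ
  module OΓ = GraphOps Γ
  module OΔ = GraphOps Δ

  from-adj : ∀ {a b} → a ∈ Graph.vs Δ → b ∈ Graph.vs Δ →
             T (Graph.adj Δ a b) → T (Graph.adj Γ (from a) (from b))
  from-adj {a} {b} a∈ b∈ = subst T (trans (cong₂ (Graph.adj Δ) (sym (to-from a a∈)) (sym (to-from b b∈)))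
                                          (adj-pres (from a) (from b) (from∈ a a∈) (from∈ b b∈)))

  module From = TubeImage Δ Γ from (from∈ _) (λ a∈ b∈ → inj₂ ∘ from-adj a∈ b∈)
  module To   = TubeImage Γ Δ to (to∈ _) (λ x∈ y∈ → inj₂ ∘ subst T (sym (adj-pres _ _ x∈ y∈)))

  isTube-from : ∀ A → A ⊆ Graph.vs Δ → OΔ.isTube A ≡ OΓ.isTube (map from A)
  isTube-from A A⊆vs = T-⇔⇒≡ (Γ.Tube⇒isTube ∘ From.tube-image ∘ Δ.isTube⇒Tube A)
                           (Δ.Tube⇒isTube ∘ back ∘ To.tube-image ∘ Γ.isTube⇒Tube (map from A))
    where
    back : Δ.Tube (map to (map from A)) → Δ.Tube A
    back t = Δ.tube-≐ t round-trip⊆ ⊆round-trip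
      where
      round-trip⊆ : map to (map from A) ⊆ A
      round-trip⊆ u∈ with ∈-map⁻ to u∈
      ... | _ , x∈ , refl with ∈-map⁻ from x∈
      ...   | a , a∈ , refl = subst (_∈ A) (sym (to-from a (A⊆vs a∈))) a∈
      ⊆round-trip : A ⊆ map to (map from A)
      ⊆round-trip {a} a∈ =
        subst (_∈ map to (map from A)) (to-from a (A⊆vs a∈)) (∈-map⁺ to (∈-map⁺ from a∈))

  merge-from : ∀ B c → B ++ concat c ⊆ Graph.vs Δ →
               map (map from) (Δ.merge B c) ≡ Γ.merge (map from B) (map (map from) c)
  merge-from B []       _    = refl
  merge-from B (B′ ∷ c) ⊆vs
    rewrite isTube-from (B ++ B′) (⊆vs ∘ ++⁺ ⊆-refl (xs⊆xs++ys B′ (concat c))) | List.map-++ from B B′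
    with OΓ.isTube (map from B ++ map from B′)
  ... | true  = trans (merge-from (B ++ B′) c (⊆vs ∘ subst (_ ∈_) (List.++-assoc B B′ (concat c))))
                      (cong (λ B″ → Γ.merge B″ (map (map from) c)) (List.map-++ from B B′))
  ... | false = refl

  decompose-from : ∀ w → w ⊆ Graph.vs Δ → map (map from) (Δ.decompose w) ≡ Γ.decompose (map from w)
  decompose-from []      _    = refl
  decompose-from (v ∷ w) ⊆vs =
    trans (merge-from [ v ] (Δ.decompose w)
                      (subst (λ u → v ∷ u ⊆ Graph.vs Δ) (sym (Δ.concat-decompose w)) ⊆vs))
          (cong (Γ.merge [ from v ]) (decompose-from w (⊆vs ∘ there)))

module Contraction (Γ : Graph) (G q : List (Graph.V Γ)) (G-isTube : T (GraphOps.isTube Γ G))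
                   (q-ordering : T (GraphOps.isOrderingOf Γ G q)) (q-planEq : T (GraphOps.isPlanEq Γ q)) where
  open Graph Γ
  open GraphOps Γ
  open GraphTheory Γ
  module Γ/G = GraphTheory (contract Γ G)
  module O/G = GraphOps (contract Γ G)
  open import Data.List.Membership.DecPropositional _≟_ using (_∈?_)

  vs/G : List (Maybe V)
  vs/G = Graph.vs (contract Γ G)

  G-tube : Tube G
  G-tube = isTube⇒Tube G G-isTube

  q⊆G : q ⊆ G
  q⊆G = proj₁ (isOrderingOf⇒⊆ G q q-ordering)

  G⊆q : G ⊆ q
  G⊆q = proj₂ (isOrderingOf⇒⊆ G q q-ordering)

  just∈vs/G : ∀ {v} → just v ∈ vs/G → v ∈ vs × v ∉ G
  just∈vs/G (there v∈) with ∈-map⁻ just v∈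
  ... | _ , v∈rest , refl with ∈-filter⁻ (T? ∘ λ v → not (v ∈ᵇ G)) v∈rest
  ...   | v∈vs , v∉G = v∈vs , T-not⁻ v∉G ∘ ∈⇒∈ᵇ

  fibre : Maybe V → List V
  fibre = substVertex q

  expand : List (Maybe V) → List V
  expand = substOrd q

  fibre-inhabited : ∀ α → ∃[ x ] x ∈ fibre α
  fibre-inhabited nothing  = _ , G⊆q (proj₂ (inhabited G-tube))
  fibre-inhabited (just v) = v , here refl

  fibre-≢[] : ∀ α → fibre α ≢ []
  fibre-≢[] α fibre≡[] with subst (proj₁ (fibre-inhabited α) ∈_) fibre≡[] (proj₂ (fibre-inhabited α))
  ... | ()

  module _ {B : List (Maybe V)} where

    G⊆expand : nothing ∈ B → G ⊆ expand B
    G⊆expand n∈ = ∈-substOrd⁺ n∈ ∘ G⊆q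

    -- A path of Γ/G through {G} is lifted by walking inside the tube G.
    lift : ∀ {α β x y} → α ∈ B → Γ/G.Path B α β → x ∈ fibre α → y ∈ fibre β →
           Path (expand B) x y
    lift {nothing} n∈ ε x∈ y∈ = path-mono (G⊆expand n∈) (connected G-tube (q⊆G x∈) (q⊆G y∈))
    lift {just v}  v∈ ε (here refl) (here refl) = ε
    lift {just u}  {x = u} u∈ ((_ , γ∈ , a) ◅ p) (here refl) y∈ = step γ∈ a p y∈
      where
      step : ∀ {γ β y} → γ ∈ B → T (Graph.adj (contract Γ G) (just u) γ) → Γ/G.Path B γ β →
             y ∈ fibre β → Path (expand B) u y
      step {just v}  v∈ a p y∈ =
        (∈-substOrd⁺ u∈ (here refl) , ∈-substOrd⁺ v∈ (here refl) , a) ◅ lift v∈ p (here refl) y∈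
      step {nothing} n∈ a p y∈ with find (any⁻ _ G a)
      ... | g , g∈G , a′ =
        (∈-substOrd⁺ u∈ (here refl) , G⊆expand n∈ g∈G , a′) ◅ lift n∈ p (G⊆q g∈G) y∈
    lift {nothing} {x = x} n∈ ((_ , γ∈ , a) ◅ p) x∈ y∈ = step γ∈ a p y∈
      where
      step : ∀ {γ β y} → γ ∈ B → T (Graph.adj (contract Γ G) nothing γ) → Γ/G.Path B γ β →
             y ∈ fibre β → Path (expand B) x y
      step {nothing} _  () _ _
      step {just v}  v∈ a  p y∈ with find (any⁻ _ G a)
      ... | g , g∈G , a′ =
        path-mono (G⊆expand n∈) (connected G-tube (q⊆G x∈) g∈G)
          ◅◅ (G⊆expand n∈ g∈G , ∈-substOrd⁺ v∈ (here refl) , adjacent-sym a′)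
          ◅  lift v∈ p (here refl) y∈

    tube-lift : Γ/G.Tube B → Tube (expand B)
    tube-lift (Γ/G.tube (α , α∈) B⊆vs/G conn) with fibre-inhabited α
    ... | x , x∈α = tube (x , ∈-substOrd⁺ α∈ x∈α) expand⊆vs connected′
      where
      expand⊆vs : expand B ⊆ vs
      expand⊆vs x∈ with ∈-substOrd⁻ B x∈
      ... | nothing , _  , x∈q        = ⊆vs G-tube (q⊆G x∈q)
      ... | just v  , v∈ , here refl = proj₁ (just∈vs/G (B⊆vs/G v∈))
      connected′ : ConnectedOn (expand B)
      connected′ x∈ y∈ with ∈-substOrd⁻ B x∈ | ∈-substOrd⁻ B y∈
      ... | _ , α∈ , x∈α | _ , β∈ , y∈β = lift α∈ (conn α∈ β∈) x∈α y∈β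

  π : V → Maybe V
  π x = if x ∈ᵇ G then nothing else just x

  π-∈G : ∀ {x} → x ∈ G → π x ≡ nothing
  π-∈G {x} x∈ with x ∈ᵇ G | ∈⇒∈ᵇ {x} {G} x∈
  ... | true | _ = refl

  π-∉G : ∀ {x} → x ∉ G → π x ≡ just x
  π-∉G {x} x∉ with x ∈ᵇ G in x∈?
  ... | true  = ⊥-elim (x∉ (∈ᵇ⇒∈ G (subst T (sym x∈?) tt)))
  ... | false = refl

  π-vs : ∀ {x} → x ∈ vs → π x ∈ vs/G
  π-vs {x} x∈ with x ∈? G
  ... | yes x∈G rewrite π-∈G x∈G = here refl
  ... | no  x∉G rewrite π-∉G x∉G =
    there (∈-map⁺ just (∈-filter⁺ (T? ∘ λ v → not (v ∈ᵇ G)) x∈ (T-not⁺ (x∉G ∘ ∈ᵇ⇒∈ G))))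

  π-adj : ∀ {x y} → x ∈ vs → y ∈ vs → T (adj x y) →
          π x ≡ π y ⊎ T (Graph.adj (contract Γ G) (π x) (π y))
  π-adj {x} {y} _ _ a with x ∈? G | y ∈? G
  ... | yes x∈G | yes y∈G rewrite π-∈G x∈G | π-∈G y∈G = inj₁ refl
  ... | yes x∈G | no  y∉G rewrite π-∈G x∈G | π-∉G y∉G =
    inj₂ (any⁺ _ (Any.map (λ { refl → adjacent-sym a }) x∈G))
  ... | no  x∉G | yes y∈G rewrite π-∉G x∉G | π-∈G y∈G =
    inj₂ (any⁺ _ (Any.map (λ { refl → a }) y∈G))
  ... | no  x∉G | no  y∉G rewrite π-∉G x∉G | π-∉G y∉G = inj₂ a

  π-fibre : ∀ {α x} → α ∈ vs/G → x ∈ fibre α → π x ≡ α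
  π-fibre {nothing} _  x∈q       = π-∈G (q⊆G x∈q)
  π-fibre {just v}  v∈ (here refl) = π-∉G (proj₂ (just∈vs/G v∈))

  module Quotient = TubeImage Γ (contract Γ G) π π-vs π-adj

  -- expand B is the preimage of B under π.
  tube-descend : ∀ {B} → B ⊆ vs/G → Tube (expand B) → Γ/G.Tube B
  tube-descend {B} B⊆vs/G t = Γ/G.tube-≐ (Quotient.tube-image t) image⊆B B⊆image
    where
    image⊆B : map π (expand B) ⊆ B
    image⊆B u∈ with ∈-map⁻ π u∈
    ... | x , x∈ , refl with ∈-substOrd⁻ B x∈
    ...   | α , α∈ , x∈α = subst (_∈ B) (sym (π-fibre (B⊆vs/G α∈) x∈α)) α∈
    B⊆image : B ⊆ map π (expand B)
    B⊆image {α} α∈ with fibre-inhabited α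
    ... | x , x∈α =
      subst (_∈ map π (expand B)) (π-fibre (B⊆vs/G α∈) x∈α) (∈-map⁺ π (∈-substOrd⁺ α∈ x∈α))

  isTube-expand⁺ : ∀ B → T (O/G.isTube B) → T (isTube (expand B))
  isTube-expand⁺ B = Tube⇒isTube ∘ tube-lift ∘ Γ/G.isTube⇒Tube B

  isTube-expand⁻ : ∀ B → B ⊆ vs/G → T (isTube (expand B)) → T (O/G.isTube B)
  isTube-expand⁻ B B⊆vs/G = Γ/G.Tube⇒isTube ∘ tube-descend B⊆vs/G ∘ isTube⇒Tube (expand B)

  planar-expand : ∀ {B} → Γ/G.Planar B → Planar (expand B)
  planar-expand (Γ/G.leaf nothing)  =
    subst Planar (sym (List.++-identityʳ q)) (proj₂ (isPlanEq⇒PlanarTube q q-planEq))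
  planar-expand (Γ/G.leaf (just v)) = leaf v
  planar-expand (Γ/G.node {L} {R} tL tR pL pR) =
    subst Planar (sym (substOrd-++ q L R))
          (node (isTube-expand⁺ L tL) (isTube-expand⁺ R tR) (planar-expand pL) (planar-expand pR))

  separated-expand : ∀ b → All Γ/G.PlanarTube b → T (O/G.consecutiveNonAdj b) →
                     T (consecutiveNonAdj (map expand b))
  separated-expand []           _ _ = tt
  separated-expand (B ∷ [])     _ _ = tt
  separated-expand (B ∷ B′ ∷ b) ((tB , _) ∷ blocks@((tB′ , _) ∷ _)) sep =
    T-∧⁺ (T-not⁺ (T-not⁻ (proj₁ separated)
                  ∘ isTube-expand⁻ (B ++ B′) (++-⊆ (⊆vs/G B tB) (⊆vs/G B′ tB′))
                  ∘ subst (T ∘ isTube) (sym (substOrd-++ q B B′))))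
         (separated-expand (B′ ∷ b) blocks (proj₂ separated))
    where
    separated : T (not (O/G.isTube (B ++ B′))) × T (O/G.consecutiveNonAdj (B′ ∷ b))
    separated = T-∧⁻ {not (O/G.isTube (B ++ B′))} sep
    ⊆vs/G : ∀ A → T (O/G.isTube A) → A ⊆ vs/G
    ⊆vs/G A = Γ/G.⊆vs ∘ Γ/G.isTube⇒Tube A

  chain-expand : ∀ {b} → Γ/G.Chain b → Chain (map expand b)
  chain-expand {b} (Γ/G.chain blocks sep) =
    chain (All-map⁺ (All.map (λ {B} (tB , pB) → isTube-expand⁺ B tB , planar-expand pB) blocks))
          (separated-expand b blocks sep)

  decompose-expand : ∀ {b} → Γ/G.Chain b → expand (concat b) ⊆ vs → decompose (expand (concat b)) ≡ map expand b
  decompose-expand {b} b-chain ⊆vs =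
    chain-unique (decompose-chain ⊆vs) (chain-expand b-chain)
                 (trans (concat-decompose (expand (concat b))) (sym (concat-map-substOrd q b)))

  expand-injective : ∀ u t → u ⊆ vs/G → t ⊆ vs/G → expand u ≡ expand t → u ≡ t
  expand-injective []      []      _  _  _ = refl
  expand-injective []      (β ∷ t) _  _  e =
    ⊥-elim (fibre-≢[] β (List.++-conicalˡ (fibre β) (expand t) (sym e)))
  expand-injective (α ∷ u) []      _  _  e =
    ⊥-elim (fibre-≢[] α (List.++-conicalˡ (fibre α) (expand u) e))
  expand-injective (nothing ∷ u) (nothing ∷ t) u⊆ t⊆ e =
    cong (nothing ∷_) (expand-injective u t (u⊆ ∘ there) (t⊆ ∘ there)
                                        (List.++-cancelˡ q (expand u) (expand t) e))
  expand-injective (just a ∷ u) (just b ∷ t) u⊆ t⊆ e with List.∷-injective e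
  ... | refl , e′ = cong (just a ∷_) (expand-injective u t (u⊆ ∘ there) (t⊆ ∘ there) e′)
  expand-injective (nothing ∷ u) (just b ∷ t) _ t⊆ e =
    ⊥-elim (proj₂ (just∈vs/G (t⊆ (here refl))) (q⊆G (++-head q (fibre-≢[] nothing) e)))
  expand-injective (just a ∷ u) (nothing ∷ t) u⊆ _ e =
    ⊥-elim (proj₂ (just∈vs/G (u⊆ (here refl))) (q⊆G (++-head q (fibre-≢[] nothing) (sym e))))

module Multiplicity {B : Set} (_≟_ : DecidableEquality B) where

  multiplicity : B → List B → ℕ
  multiplicity t []      = 0
  multiplicity t (u ∷ L) with u ≟ t
  ... | yes _ = suc (multiplicity t L)
  ... | no  _ = multiplicity t L

  multiplicity-++ : ∀ t L M → multiplicity t (L ++ M) ≡ multiplicity t L + multiplicity t M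
  multiplicity-++ t []      M = refl
  multiplicity-++ t (u ∷ L) M with u ≟ t
  ... | yes _ = cong suc (multiplicity-++ t L M)
  ... | no  _ = multiplicity-++ t L M

  multiplicity-absent : ∀ t L → (∀ {u} → u ∈ L → u ≢ t) → multiplicity t L ≡ 0
  multiplicity-absent t []      _      = refl
  multiplicity-absent t (u ∷ L) absent with u ≟ t
  ... | yes u≡t = ⊥-elim (absent (here refl) u≡t)
  ... | no  _   = multiplicity-absent t L (absent ∘ there)

  multiplicity-zero : ∀ t L → multiplicity t L ≡ 0 → ∀ {u} → u ∈ L → u ≢ t
  multiplicity-zero t (u ∷ L) m≡0 u∈ with u ≟ t | u∈
  multiplicity-zero t (u ∷ L) ()  u∈ | yes _   | _
  ... | no u≢t | here refl = u≢t
  ... | no _   | there u∈′ = multiplicity-zero t L m≡0 u∈′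

  multiplicity-map : ∀ {f : B → B} → (∀ {x y} → f x ≡ f y → x ≡ y) →
                     ∀ t L → multiplicity (f t) (map f L) ≡ multiplicity t L
  multiplicity-map         f-inj t []      = refl
  multiplicity-map {f = f} f-inj t (u ∷ L) with f u ≟ f t | u ≟ t
  ... | yes _   | yes _    = cong suc (multiplicity-map f-inj t L)
  ... | no  _   | no  _    = multiplicity-map f-inj t L
  ... | yes e   | no  u≢t = ⊥-elim (u≢t (f-inj e))
  ... | no  e≢  | yes refl = ⊥-elim (e≢ refl)

module Permutations {A : Set} (_≟_ : DecidableEquality A) where
  _≟ₗ_ : DecidableEquality (List A)
  _≟ₗ_ = List.≡-dec _≟_

  open Multiplicity _≟ₗ_

  insertions-shape : ∀ (x : A) p {z} → z ∈ insertions x p →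
                     ∃[ p₁ ] ∃[ p₂ ] z ≡ p₁ ++ x ∷ p₂ × p ≡ p₁ ++ p₂
  insertions-shape x []      (here refl) = [] , [] , refl , refl
  insertions-shape x (y ∷ p) (here refl) = [] , y ∷ p , refl , refl
  insertions-shape x (y ∷ p) (there z∈) with ∈-map⁻ (y ∷_) z∈
  ... | _ , z∈′ , refl with insertions-shape x p z∈′
  ...   | p₁ , p₂ , z≡ , p≡ = y ∷ p₁ , p₂ , cong (y ∷_) z≡ , cong (y ∷_) p≡

  ∈-insertions⁻ : ∀ (x : A) p {z} → z ∈ insertions x p → z ⊆ x ∷ p
  ∈-insertions⁻ x p z∈ with insertions-shape x p z∈
  ... | p₁ , p₂ , refl , refl = ++-⊆ (there ∘ xs⊆xs++ys p₁ p₂) (∷⁺ʳ x (xs⊆ys++xs p₂ p₁))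

  ∈-perms⁻ : ∀ (xs : List A) {u} → u ∈ perms xs → u ⊆ xs
  ∈-perms⁻ []       (here refl) ()
  ∈-perms⁻ (x ∷ xs) u∈ with find (Any-map⁻ (∈-concat⁻ (map (insertions x) (perms xs)) u∈))
  ... | p , p∈ , u∈ins = ⊆-trans (∈-insertions⁻ x p u∈ins) (∷⁺ʳ x (∈-perms⁻ xs p∈))

  ∷-middle-cancel : ∀ (x : A) p₁ p₂ t₁ t₂ → x ∉ t₁ → x ∉ t₂ →
                    p₁ ++ x ∷ p₂ ≡ t₁ ++ x ∷ t₂ → p₁ ++ p₂ ≡ t₁ ++ t₂
  ∷-middle-cancel x p₁ p₂ t₁ t₂ x∉t₁ x∉t₂ e with ++-≡-++ p₁ (x ∷ p₂) t₁ (x ∷ t₂) e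
  ... | inj₁ ([] , t₁≡ , e′) =
    cong₂ _++_ (sym (trans t₁≡ (List.++-identityʳ p₁))) (List.∷-injectiveʳ e′)
  ... | inj₂ ([] , p₁≡ , e′) =
    cong₂ _++_ (trans p₁≡ (List.++-identityʳ t₁)) (sym (List.∷-injectiveʳ e′))
  ... | inj₁ (_ ∷ m , t₁≡ , e′) with List.∷-injective e′
  ...   | refl , _ = ⊥-elim (x∉t₁ (subst (x ∈_) (sym t₁≡) (∈-++⁺ʳ p₁ (here refl))))
  ∷-middle-cancel x p₁ p₂ t₁ t₂ x∉t₁ x∉t₂ e | inj₂ (_ ∷ n , p₁≡ , e′) with List.∷-injective e′
  ...   | refl , t₂≡ = ⊥-elim (x∉t₂ (subst (x ∈_) (sym t₂≡) (∈-++⁺ʳ n (here refl))))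

  multiplicity-insertions-other : ∀ (x : A) p t₁ t₂ → x ∉ t₁ → x ∉ t₂ → p ≢ t₁ ++ t₂ →
                                  multiplicity (t₁ ++ x ∷ t₂) (insertions x p) ≡ 0
  multiplicity-insertions-other x p t₁ t₂ x∉t₁ x∉t₂ p≢ = multiplicity-absent _ _ not-t
    where
    not-t : ∀ {u} → u ∈ insertions x p → u ≢ t₁ ++ x ∷ t₂
    not-t u∈ e with insertions-shape x p u∈
    ... | p₁ , p₂ , refl , refl = p≢ (∷-middle-cancel x p₁ p₂ t₁ t₂ x∉t₁ x∉t₂ e)

  multiplicity-insertions-self : ∀ (x : A) t₁ t₂ → x ∉ t₁ → x ∉ t₂ →
                                 multiplicity (t₁ ++ x ∷ t₂) (insertions x (t₁ ++ t₂)) ≡ 1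
  multiplicity-insertions-self x [] [] _ _ with [ x ] ≟ₗ [ x ]
  ... | yes _  = refl
  ... | no  ≢x = ⊥-elim (≢x refl)
  multiplicity-insertions-self x [] (y ∷ t₂) _ x∉t₂ with (x ∷ y ∷ t₂) ≟ₗ (x ∷ y ∷ t₂)
  ... | no  ≢t = ⊥-elim (≢t refl)
  ... | yes _  = cong suc (multiplicity-absent _ _ starts-with-y)
    where
    starts-with-y : ∀ {u} → u ∈ map (y ∷_) (insertions x t₂) → u ≢ x ∷ y ∷ t₂
    starts-with-y u∈ e with ∈-map⁻ (y ∷_) u∈
    ... | _ , _ , refl with List.∷-injective e
    ...   | refl , _ = x∉t₂ (here refl)
  multiplicity-insertions-self x (a ∷ t₁) t₂ x∉t₁ x∉t₂
    with (x ∷ a ∷ t₁ ++ t₂) ≟ₗ (a ∷ t₁ ++ x ∷ t₂)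
  ... | yes e = ⊥-elim (x∉t₁ (here (List.∷-injectiveˡ e)))
  ... | no  _ = trans (multiplicity-map List.∷-injectiveʳ (t₁ ++ x ∷ t₂) (insertions x (t₁ ++ t₂)))
                      (multiplicity-insertions-self x t₁ t₂ (x∉t₁ ∘ there) x∉t₂)

  multiplicity-concatMap-insertions : ∀ (x : A) t₁ t₂ L → x ∉ t₁ → x ∉ t₂ →
    multiplicity (t₁ ++ x ∷ t₂) (concatMap (insertions x) L) ≡ multiplicity (t₁ ++ t₂) L
  multiplicity-concatMap-insertions x t₁ t₂ []      _     _     = refl
  multiplicity-concatMap-insertions x t₁ t₂ (p ∷ L) x∉t₁ x∉t₂
    rewrite multiplicity-++ (t₁ ++ x ∷ t₂) (insertions x p) (concatMap (insertions x) L)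
          | multiplicity-concatMap-insertions x t₁ t₂ L x∉t₁ x∉t₂
    with p ≟ₗ (t₁ ++ t₂)
  ... | yes refl =
    cong (_+ multiplicity (t₁ ++ t₂) L) (multiplicity-insertions-self x t₁ t₂ x∉t₁ x∉t₂)
  ... | no  p≢  =
    cong (_+ multiplicity (t₁ ++ t₂) L) (multiplicity-insertions-other x p t₁ t₂ x∉t₁ x∉t₂ p≢)

  unique-middle : ∀ t₁ (x : A) t₂ → Unique (t₁ ++ x ∷ t₂) →
                  x ∉ t₁ × x ∉ t₂ × Unique (t₁ ++ t₂)
  unique-middle []       x t₂ (x∉ ∷ u) = (λ ()) , (λ x∈ → All.lookup x∉ x∈ refl) , u
  unique-middle (a ∷ t₁) x t₂ (a∉ ∷ u) with unique-middle t₁ x t₂ u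
  ... | x∉t₁ , x∉t₂ , u′ = x∉a∷t₁ , x∉t₂ , All.tabulate a∉t₁++t₂ ∷ u′
    where
    x∉a∷t₁ : x ∉ a ∷ t₁
    x∉a∷t₁ (here refl) = All.lookup a∉ (∈-++⁺ʳ t₁ (here refl)) refl
    x∉a∷t₁ (there x∈)  = x∉t₁ x∈
    a∉t₁++t₂ : ∀ {y} → y ∈ t₁ ++ t₂ → a ≢ y
    a∉t₁++t₂ y∈ with ∈-++⁻ t₁ y∈
    ... | inj₁ y∈t₁ = All.lookup a∉ (∈-++⁺ˡ y∈t₁)
    ... | inj₂ y∈t₂ = All.lookup a∉ (∈-++⁺ʳ t₁ (there y∈t₂))

  perms-multiplicity : ∀ xs t → Unique xs → Unique t → t ⊆ xs → xs ⊆ t → multiplicity t (perms xs) ≡ 1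
  perms-multiplicity []       []      _ _ _ _ = refl
  perms-multiplicity []       (_ ∷ _) _ _ t⊆ _ with t⊆ (here refl)
  ... | ()
  perms-multiplicity (x ∷ xs) t (x∉xs ∷ u-xs) u-t t⊆ ⊆t with ∈-∃++ (⊆t (here refl))
  ... | t₁ , t₂ , refl with unique-middle t₁ x t₂ u-t
  ...   | x∉t₁ , x∉t₂ , u-t′ =
    trans (multiplicity-concatMap-insertions x t₁ t₂ (perms xs) x∉t₁ x∉t₂)
          (perms-multiplicity xs (t₁ ++ t₂) u-xs u-t′ t′⊆xs xs⊆t′)
    where
    t′⊆xs : t₁ ++ t₂ ⊆ xs
    t′⊆xs y∈ with ∈-++⁻ t₁ y∈
    ... | inj₁ y∈t₁ with t⊆ (∈-++⁺ˡ y∈t₁)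
    ...   | here refl = ⊥-elim (x∉t₁ y∈t₁)
    ...   | there y∈  = y∈
    t′⊆xs y∈ | inj₂ y∈t₂ with t⊆ (∈-++⁺ʳ t₁ (there y∈t₂))
    ...   | here refl = ⊥-elim (x∉t₂ y∈t₂)
    ...   | there y∈  = y∈
    xs⊆t′ : xs ⊆ t₁ ++ t₂
    xs⊆t′ y∈ with ∈-++⁻ t₁ (⊆t (there y∈))
    ... | inj₁ y∈t₁          = ∈-++⁺ˡ y∈t₁
    ... | inj₂ (here refl)   = ⊥-elim (All.lookup x∉xs y∈ refl)
    ... | inj₂ (there y∈t₂) = ∈-++⁺ʳ t₁ y∈t₂

module Sums {c ℓ : Level} (F : Field c ℓ) where
  open Field F renaming (refl to ≈-refl; trans to ≈-trans)
  open LinearAlgebra F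

  sumF-zero : ∀ {A : Set} (f : A → Carrier) L → (∀ {u} → u ∈ L → f u ≈ 0#) → sumF (map f L) ≈ 0#
  sumF-zero f []      _     = ≈-refl
  sumF-zero f (u ∷ L) zeros =
    ≈-trans (+-cong (zeros (here refl)) (sumF-zero f L (zeros ∘ there))) (+-identityˡ 0#)

  sumF-single : ∀ {A : Set} (_≟_ : DecidableEquality A) (f : A → Carrier) L t →
                Multiplicity.multiplicity _≟_ t L ≡ 1 → (∀ {u} → u ∈ L → u ≢ t → f u ≈ 0#) →
                sumF (map f L) ≈ f t
  sumF-single _≟_ f (u ∷ L) t once zeros with u ≟ t
  ... | yes refl =
    ≈-trans (+-cong ≈-refl (sumF-zero f L (λ u∈ → zeros (there u∈) (absent u∈)))) (+-identityʳ (f u))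
    where
    absent : ∀ {u′} → u′ ∈ L → u′ ≢ u
    absent = Multiplicity.multiplicity-zero _≟_ u L (suc-injective once)
  ... | no  u≢t  =
    ≈-trans (+-cong (zeros (here refl) u≢t) (sumF-single _≟_ f L t once (zeros ∘ there))) (+-identityˡ (f t))

  δ-same : ∀ {A : Set} (_≟_ : DecidableEquality A) a → δ _≟_ a a ≈ 1#
  δ-same _≟_ a with a ≟ a
  ... | yes _   = ≈-refl
  ... | no  a≢a = ⊥-elim (a≢a refl)

  δ-distinct : ∀ {A : Set} (_≟_ : DecidableEquality A) a a′ → a ≢ a′ → δ _≟_ a a′ ≈ 0#
  δ-distinct _≟_ a a′ a≢a′ with a ≟ a′
  ... | yes a≡a′ = ⊥-elim (a≢a′ a≡a′)
  ... | no  _    = ≈-refl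

module FreeModule {c ℓ : Level} (F : Field c ℓ) where
  open Field F renaming (refl to ≈-refl; sym to ≈-sym; trans to ≈-trans)
  open LinearAlgebra F
  open Sums F

  -- Vectors are coordinate functions, so ψ sends the basis vector of a chain c to that of
  -- concat c.
  ψ : (Γ : Graph) → Connected F Γ → LinMap (HPBasis F Γ) (PermBasis F Γ)
  ψ Γ _ = record
    { app      = λ x w → x (decompose w)
    ; resp     = λ x y x≈y w w-ord → x≈y (decompose w) (decompose-isHamPlan w w-ord)
    ; additive = λ _ _ _ _ → ≈-refl
    ; homog    = λ _ _ _ _ → ≈-refl
    }
    where open GraphTheory Γ

  φ : (Γ : Graph) → Connected F Γ → LinMap (PermBasis F Γ) (HPBasis F Γ)
  φ Γ _ = record
    { app      = λ y c → y (concat c)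
    ; resp     = λ x y x≈y c c-hp → x≈y (concat c) (proj₁ (isHamPlan⇒Chain c c-hp))
    ; additive = λ _ _ _ _ → ≈-refl
    ; homog    = λ _ _ _ _ → ≈-refl
    }
    where open GraphTheory Γ

  module ModuleMap (Γ : Graph) (G q : List (Graph.V Γ)) (G-isTube : T (GraphOps.isTube Γ G))
                   (q-ordering : T (GraphOps.isOrderingOf Γ G q)) (q-planEq : T (GraphOps.isPlanEq Γ q))
                   (b : List (List (Maybe (Graph.V Γ)))) (b-hp : T (HPBasis F (contract Γ G) b)) where
    open Graph Γ using (V)
    open GraphOps Γ using (isOrdering)
    open GraphTheory Γ
    open Contraction Γ G q G-isTube q-ordering q-planEq
    open Permutations (Graph._≟_ (contract Γ G)) using (perms-multiplicity; ∈-perms⁻)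

    b-ordering : T (O/G.isOrdering (concat b))
    b-ordering = proj₁ (Γ/G.isHamPlan⇒Chain b b-hp)

    concat-b⊆vs/G : concat b ⊆ vs/G
    concat-b⊆vs/G = Γ/G.isOrdering⇒⊆vs (concat b) b-ordering

    lhs : List V → Carrier
    lhs w = δ (decHP F Γ) (map expand b) (decompose w)

    summand : List V → List (Maybe V) → Carrier
    summand w u = if does (decOrd F Γ (expand u) w) then δ (decHP F (contract Γ G)) b (Γ/G.decompose u) else 0#

    rhs : List V → Carrier
    rhs w = sumF (map (summand w) (perms vs/G))

    at-image : ∀ w → T (isOrdering w) → w ≡ expand (concat b) → lhs w ≈ 1# × rhs w ≈ 1#
    at-image w w-ord refl =
      subst (λ c → δ (decHP F Γ) (map expand b) c ≈ 1#)
            (sym (decompose-expand (proj₂ (Γ/G.isHamPlan⇒Chain b b-hp)) (isOrdering⇒⊆vs w w-ord)))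
            (δ-same (decHP F Γ) (map expand b)) ,
      ≈-trans (sumF-single (decOrd F (contract Γ G)) (summand w) (perms vs/G) (concat b) once elsewhere) at-b
      where
      once : Multiplicity.multiplicity (decOrd F (contract Γ G)) (concat b) (perms vs/G) ≡ 1
      once = perms-multiplicity vs/G (concat b) (Graph.vs-unique (contract Γ G))
               (Γ/G.uniqueᵇ⇒Unique (concat b) (proj₁ (T-∧⁻ b-ordering)))
               concat-b⊆vs/G (proj₂ (Γ/G.isOrderingOf⇒⊆ vs/G (concat b) b-ordering))
      elsewhere : ∀ {u} → u ∈ perms vs/G → u ≢ concat b → summand w u ≈ 0#
      elsewhere {u} u∈ u≢ with decOrd F Γ (expand u) w
      ... | no  _       = ≈-refl
      ... | yes expand≡ = ⊥-elim (u≢ (expand-injective u (concat b) (∈-perms⁻ vs/G u∈) concat-b⊆vs/G expand≡))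
      at-b : summand w (concat b) ≈ 1#
      at-b with decOrd F Γ (expand (concat b)) w
      ... | yes _  = subst (λ c → δ (decHP F (contract Γ G)) b c ≈ 1#) (sym (Γ/G.decompose-concat b b-hp))
                           (δ-same (decHP F (contract Γ G)) b)
      ... | no  ≢w = ⊥-elim (≢w refl)

    off-image : ∀ w → w ≢ expand (concat b) → lhs w ≈ 0# × rhs w ≈ 0#
    off-image w w≢ =
      δ-distinct (decHP F Γ) (map expand b) (decompose w) (w≢ ∘ recover) ,
      sumF-zero (summand w) (perms vs/G) vanishes
      where
      recover : map expand b ≡ decompose w → w ≡ expand (concat b)
      recover e = begin
        w                     ≡⟨ sym (concat-decompose w) ⟩
        concat (decompose w)  ≡⟨ cong concat (sym e) ⟩
        concat (map expand b) ≡⟨ concat-map-substOrd q b ⟩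
        expand (concat b)     ∎
        where open ≡-Reasoning
      vanishes : ∀ {u} → u ∈ perms vs/G → summand w u ≈ 0#
      vanishes {u} _ with decOrd F Γ (expand u) w
      ... | no  _       = ≈-refl
      ... | yes expand≡ = δ-distinct (decHP F (contract Γ G)) b (Γ/G.decompose u) λ b≡ →
            w≢ (trans (sym expand≡) (cong expand (trans (sym (Γ/G.concat-decompose u)) (cong concat (sym b≡)))))

    lhs≈rhs : ∀ w → T (isOrdering w) → lhs w ≈ rhs w
    lhs≈rhs w w-ord with decOrd F Γ w (expand (concat b))
    ... | yes w≡ = let (l , r) = at-image w w-ord w≡ in ≈-trans l (≈-sym r)
    ... | no  w≢ = let (l , r) = off-image w w≢      in ≈-trans l (≈-sym r)

theorem3p4p1 : ∀ {c ℓ : Level} (F : Field c ℓ) → PermFreeOverPlanEq F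
theorem3p4p1 F = record
  { ψ          = ψ
  ; φ          = φ
  ; ψφ         = λ Γ _ x w _ → ≈-reflexive (cong x (GraphTheory.concat-decompose Γ w))
  ; φψ         = λ Γ _ x c c-hp → ≈-reflexive (cong x (GraphTheory.decompose-concat Γ c c-hp))
  ; natural    = λ Γ Δ _ _ σ x w w-ord →
                   ≈-reflexive (cong x (Isomorphism.decompose-from σ w (GraphTheory.isOrdering⇒⊆vs Δ w w-ord)))
  ; module-map = λ Γ _ G G-tube _ q q-ok b b-hp w w-ord →
                   let (q-ordering , q-planEq) = T-∧⁻ {GraphOps.isOrderingOf Γ G q} q-ok
                   in ModuleMap.lhs≈rhs Γ G q G-tube q-ordering q-planEq b b-hp w w-ord
  }
  where
  open FreeModule F
  open Field F using () renaming (reflexive to ≈-reflexive)
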